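{- Let $W_n$ be the set of elements of the triangle group $T$ that can be written as a word of length at most $n$ in the generators $S_1,S_2,S_3,S_4$. Then $|W_n|=O(\lambda^n)$, where $\lambda=\frac{1+\sqrt{13}}{2}$.
   Context: The triangle group $T\subset GL(4,\mathbb{Z})$ is generated by $S_1=\begin{pmatrix}-1&1&1&1\\0&1&0&0\\0&0&1&0\\0&0&0&1\end{pmatrix}$, $S_2=\begin{pmatrix}1&0&0&0\\1&-1&1&1\\0&0&1&0\\0&0&0&1\end{pmatrix}$, $S_3=\begin{pmatrix}1&0&0&0\\0&1&0&0\\1&1&-1&1\\0&0&0&1\end{pmatrix}$, $S_4=\begin{pmatrix}1&0&0&0\\0&1&0&0\\0&0&1&0\\1&1&1&-1\end{pmatrix}$. -}

module Defs where

open import Data.Nat using (ℕ; zero; suc; _+_; _*_; _∸_; _≤_)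
open import Data.Integer as ℤ using (ℤ; +_; -[1+_])
open import Data.Fin using (Fin; zero; suc)
open import Data.Vec using (Vec; []; _∷_; lookup; tabulate; foldr)
open import Data.List using (List; []; _∷_; length)
open import Data.Product using (Σ; _×_; _,_)
open import Data.Sum using (_⊎_)
open import Relation.Binary.PropositionalEquality using (_≡_)

Mat : Set
Mat = Vec (Vec ℤ 4) 4

_⊗_ : Mat → Mat → Mat
A ⊗ B = tabulate λ i → tabulate λ j →
  foldr (λ _ → ℤ) ℤ._+_ (+ 0) (tabulate λ k → lookup (lookup A i) k ℤ.* lookup (lookup B k) j)

I₄ : Mat
I₄ = (+ 1 ∷ + 0 ∷ + 0 ∷ + 0 ∷ []) ∷ (+ 0 ∷ + 1 ∷ + 0 ∷ + 0 ∷ []) ∷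
     (+ 0 ∷ + 0 ∷ + 1 ∷ + 0 ∷ []) ∷ (+ 0 ∷ + 0 ∷ + 0 ∷ + 1 ∷ []) ∷ []

private
  m1 : ℤ
  m1 = -[1+ 0 ]
  o z : ℤ
  o = + 1
  z = + 0

S : Fin 4 → Mat
S zero = (m1 ∷ o ∷ o ∷ o ∷ []) ∷ (z ∷ o ∷ z ∷ z ∷ []) ∷ (z ∷ z ∷ o ∷ z ∷ []) ∷ (z ∷ z ∷ z ∷ o ∷ []) ∷ []
S (suc zero) = (o ∷ z ∷ z ∷ z ∷ []) ∷ (o ∷ m1 ∷ o ∷ o ∷ []) ∷ (z ∷ z ∷ o ∷ z ∷ []) ∷ (z ∷ z ∷ z ∷ o ∷ []) ∷ []
S (suc (suc zero)) = (o ∷ z ∷ z ∷ z ∷ []) ∷ (z ∷ o ∷ z ∷ z ∷ []) ∷ (o ∷ o ∷ m1 ∷ o ∷ []) ∷ (z ∷ z ∷ z ∷ o ∷ []) ∷ []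
S (suc (suc (suc zero))) = (o ∷ z ∷ z ∷ z ∷ []) ∷ (z ∷ o ∷ z ∷ z ∷ []) ∷ (z ∷ z ∷ o ∷ z ∷ []) ∷ (o ∷ o ∷ o ∷ m1 ∷ []) ∷ []

evalWord : List (Fin 4) → Mat
evalWord [] = I₄
evalWord (i ∷ w) = S i ⊗ evalWord w

InW : ℕ → Mat → Set
InW n M = Σ (List (Fin 4)) λ w → (length w ≤ n) × (evalWord w ≡ M)

-- (1 + √13)^n = sqP n + sqQ n · √13
sqPQ : ℕ → ℕ × ℕ
sqPQ zero = 1 , 0
sqPQ (suc n) with sqPQ n
... | p , q = p + 13 * q , p + q

-- x ≤ p + q·√13  for natural numbers x, p, q (exact, by squaring)
LeSqrt13 : ℕ → ℕ → ℕ → Set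
LeSqrt13 x p q = x ≤ p ⊎ (x ∸ p) * (x ∸ p) ≤ 13 * (q * q)

-- x ≤ C · λ^n  with λ = (1+√13)/2, i.e.  x · 2^n ≤ C·p_n + C·q_n·√13
LeCλ^ : ℕ → ℕ → ℕ → Set
LeCλ^ x C n with sqPQ n
... | p , q = LeSqrt13 (x * (2 Data.Nat.^ n)) (C * p) (C * q)

-- Every element of Wₙ is the value of a word of length at most n in which no left-hand side of a
-- finite list of relations of T occurs; each relation replaces its left-hand side by a word that
-- is no longer and shortlex-smaller, so rewriting terminates. Read from the right, such irreducible
-- words are accepted by a 50-state automaton that only remembers a prefix of the word. Weights
-- (α, β) on its states, checked by computation, show that the weight vector of the accepted words
-- of length n + 1 is at most ½ [[1,1],[13,1]] applied to that of length n, and the spectral radius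
-- of ½ [[1,1],[13,1]] is λ = (1 + √13)/2. Summing over lengths up to n and counting distinct
-- matrices by pigeonhole gives |Wₙ| = O(λⁿ).

module Submission where

open import Defs
open import Data.Empty using (⊥-elim)
open import Data.Fin using (Fin; zero; suc; toℕ; #_)
open import Data.Fin.Properties using (all?) renaming (_≟_ to _≟ᶠ_)
open import Data.Integer as ℤ using (ℤ; +_)
import Data.Integer.Properties as ℤ
open import Algebra.Properties.Semiring.Sum ℤ.+-*-semiring
  using (sum-syntax; ∑-comm; *-distribˡ-sum; *-distribʳ-sum; sum-cong-≗)
open import Data.List using (List; []; _∷_; _++_; length; map; filter; concatMap; allFin)
open import Data.List.Properties using (length-++; length-map; map-++; map-∘; length-removeAt′)
open import Data.List.Membership.Propositional using (_∈_)
open import Data.List.Membership.Propositional.Properties using (∈-++⁺ˡ; ∈-++⁺ʳ; ∈-map⁺; ∈-filter⁺; ∈-allFin; ∈-concat⁺′)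
open import Data.List.Relation.Binary.Prefix.Heterogeneous using (Prefix; []; _∷_)
open import Data.List.Relation.Binary.Prefix.Heterogeneous.Properties using (prefix?)
import Data.List.Relation.Binary.Prefix.Heterogeneous.Properties as Prefix
open import Data.List.Relation.Binary.Prefix.Propositional.Properties using (Prefix-as-∣ˡ)
open import Data.List.Relation.Unary.All as All using (All)
open import Data.List.Relation.Unary.Any as Any using (Any; here; there; any?; _─_)
open import Data.List.Relation.Unary.AllPairs using (_∷_)
open import Data.List.Relation.Unary.Unique.Propositional using (Unique)
open import Data.Nat using (ℕ; zero; suc; _+_; _*_; _∸_; _^_; _≤_; _<_; z≤n; s≤s; s≤s⁻¹)
open import Data.Nat.ListAction using (sum)
open import Data.Nat.ListAction.Properties using (sum-++)
open import Data.Nat.Induction using (<-wellFounded)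
open import Data.Nat.Properties
open import Data.Nat.Tactic.RingSolver using (solve-∀)
open import Data.Product using (Σ; _×_; _,_; proj₁; proj₂; uncurry)
open import Data.Sum using (_⊎_; inj₁; inj₂)
open import Data.Vec using (Vec; []; _∷_; lookup; tabulate)
open import Data.Vec.Properties using (lookup∘tabulate; tabulate∘lookup; tabulate-cong; ≡-dec)
open import Function using (_∘_)
open import Function.Bundles using (_⇔_; Equivalence)
open import Induction.WellFounded using (Acc; acc)
open import Relation.Binary.PropositionalEquality
open import Relation.Nullary using (Dec; yes; no; ¬_; ¬?; _×-dec_)
open import Relation.Nullary.Decidable using (from-yes; map′)

entry : Mat → Fin 4 → Fin 4 → ℤ
entry A i j = lookup (lookup A i) j

entry-⊗ : ∀ A B i j → entry (A ⊗ B) i j ≡ ∑[ k < 4 ] (entry A i k ℤ.* entry B k j)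
entry-⊗ A B i j =
  trans (cong (λ r → lookup r j) (lookup∘tabulate (λ i → tabulate (row i)) i)) (lookup∘tabulate (row i) j)
  where
  row : Fin 4 → Fin 4 → ℤ
  row i j = ∑[ k < 4 ] (entry A i k ℤ.* entry B k j)

⊗-assoc : ∀ A B C → (A ⊗ B) ⊗ C ≡ A ⊗ (B ⊗ C)
⊗-assoc A B C = tabulate-cong λ i → tabulate-cong λ j → begin
  ∑[ k < 4 ] (entry (A ⊗ B) i k ℤ.* entry C k j)
    ≡⟨ sum-cong-≗ (λ k → cong (ℤ._* entry C k j) (entry-⊗ A B i k)) ⟩
  ∑[ k < 4 ] (∑[ l < 4 ] (entry A i l ℤ.* entry B l k) ℤ.* entry C k j)
    ≡⟨ sum-cong-≗ (λ k → *-distribʳ-sum (entry C k j) (λ l → entry A i l ℤ.* entry B l k)) ⟩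
  ∑[ k < 4 ] ∑[ l < 4 ] (entry A i l ℤ.* entry B l k ℤ.* entry C k j)
    ≡⟨ ∑-comm (λ k l → entry A i l ℤ.* entry B l k ℤ.* entry C k j) ⟩
  ∑[ l < 4 ] ∑[ k < 4 ] (entry A i l ℤ.* entry B l k ℤ.* entry C k j)
    ≡⟨ sum-cong-≗ (λ l → sum-cong-≗ (λ k → ℤ.*-assoc (entry A i l) (entry B l k) (entry C k j))) ⟩
  ∑[ l < 4 ] ∑[ k < 4 ] (entry A i l ℤ.* (entry B l k ℤ.* entry C k j))
    ≡⟨ sum-cong-≗ (λ l → sym (*-distribˡ-sum (entry A i l) (λ k → entry B l k ℤ.* entry C k j))) ⟩
  ∑[ l < 4 ] (entry A i l ℤ.* ∑[ k < 4 ] (entry B l k ℤ.* entry C k j))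
    ≡⟨ sum-cong-≗ (λ l → cong (entry A i l ℤ.*_) (sym (entry-⊗ B C l j))) ⟩
  ∑[ l < 4 ] (entry A i l ℤ.* entry (B ⊗ C) l j) ∎
  where open ≡-Reasoning

sum-I₄-row : ∀ i (x : Fin 4 → ℤ) → ∑[ k < 4 ] (entry I₄ i k ℤ.* x k) ≡ x i
sum-I₄-row i x = row i
  where
  -- + 0 ℤ.* y computes to + 0, so a row sum is the unit entry among literal zeros.
  unit : ∀ y → + 1 ℤ.* y ℤ.+ + 0 ≡ y
  unit y = trans (ℤ.+-identityʳ _) (ℤ.*-identityˡ y)
  row : ∀ i → ∑[ k < 4 ] (entry I₄ i k ℤ.* x k) ≡ x i
  row zero                   = unit (x zero)
  row (suc zero)             = trans (ℤ.+-identityˡ _) (unit (x (suc zero)))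
  row (suc (suc zero))       = trans (ℤ.+-identityˡ _) (trans (ℤ.+-identityˡ _) (unit (x (suc (suc zero)))))
  row (suc (suc (suc zero))) =
    trans (ℤ.+-identityˡ _) (trans (ℤ.+-identityˡ _) (trans (ℤ.+-identityˡ _) (unit (x (suc (suc (suc zero)))))))

⊗-identityˡ : ∀ X → I₄ ⊗ X ≡ X
⊗-identityˡ X = trans
  (tabulate-cong λ i → tabulate-cong λ j → sum-I₄-row i (λ k → entry X k j))
  (trans (tabulate-cong λ i → tabulate∘lookup (lookup X i)) (tabulate∘lookup X))

∈-─ : ∀ {A : Set} {x y : A} {ys} (x∈ys : x ∈ ys) → y ∈ ys → x ≢ y → y ∈ (ys ─ x∈ys)
∈-─ (here refl) (here refl) x≢y = ⊥-elim (x≢y refl)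
∈-─ (here _)    (there y∈ys) _  = y∈ys
∈-─ (there _)   (here refl)  _  = here refl
∈-─ (there x∈ys) (there y∈ys) x≢y = there (∈-─ x∈ys y∈ys x≢y)

Unique-⊆⇒length≤ : ∀ {A : Set} {xs ys : List A} → Unique xs → (∀ {x} → x ∈ xs → x ∈ ys) → length xs ≤ length ys
Unique-⊆⇒length≤ {xs = []}     _                 _     = z≤n
Unique-⊆⇒length≤ {xs = x ∷ xs} {ys} (x∉xs ∷ unique) xs⊆ys =
  subst (suc (length xs) ≤_) (sym (length-removeAt′ ys (Any.index x∈ys)))
    (s≤s (Unique-⊆⇒length≤ unique λ y∈xs → ∈-─ x∈ys (xs⊆ys (there y∈xs)) (All.lookup x∉xs y∈xs)))
  where
  x∈ys = xs⊆ys (here refl)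

-- Growth of the recurrence with matrix [[1,1],[13,1]]

P Q : ℕ → ℕ
P n = proj₁ (sqPQ n)
Q n = proj₂ (sqPQ n)

-- [[1,1],[13,1]]ⁿ = [[P n, Q n],[13 Q n, P n]].
λ-growth : ∀ (a b : ℕ → ℕ) →
  (∀ n → 2 * a (suc n) ≤ a n + b n) → (∀ n → 2 * b (suc n) ≤ 13 * a n + b n) →
  ∀ n → a n * 2 ^ n ≤ a 0 * P n + b 0 * Q n × b n * 2 ^ n ≤ b 0 * P n + 13 * a 0 * Q n
λ-growth a b a-step b-step zero =
  ≤-reflexive (initial-value (a 0) (b 0)) , ≤-reflexive (initial-value (b 0) (13 * a 0))
  where
  initial-value : ∀ x y → x * 1 ≡ x * 1 + y * 0
  initial-value = solve-∀
λ-growth a b a-step b-step (suc n) with λ-growth a b a-step b-step n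
... | a-bound , b-bound = a-bound′ , b-bound′
  where
  open ≤-Reasoning
  t = 2 ^ n
  a-bound′ : a (suc n) * (2 * t) ≤ a 0 * P (suc n) + b 0 * Q (suc n)
  a-bound′ = begin
    a (suc n) * (2 * t)                                ≡⟨ *-assoc (a (suc n)) 2 t ⟨
    a (suc n) * 2 * t                                  ≡⟨ cong (_* t) (*-comm (a (suc n)) 2) ⟩
    2 * a (suc n) * t                                  ≤⟨ *-monoˡ-≤ t (a-step n) ⟩
    (a n + b n) * t                                    ≡⟨ *-distribʳ-+ t (a n) (b n) ⟩
    a n * t + b n * t                                  ≤⟨ +-mono-≤ a-bound b-bound ⟩
    (a 0 * P n + b 0 * Q n) + (b 0 * P n + 13 * a 0 * Q n) ≡⟨ regroup (a 0) (b 0) (P n) (Q n) ⟩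
    a 0 * (P n + 13 * Q n) + b 0 * (P n + Q n)         ∎
    where
    regroup : ∀ x y p q → (x * p + y * q) + (y * p + 13 * x * q) ≡ x * (p + 13 * q) + y * (p + q)
    regroup = solve-∀
  b-bound′ : b (suc n) * (2 * t) ≤ b 0 * P (suc n) + 13 * a 0 * Q (suc n)
  b-bound′ = begin
    b (suc n) * (2 * t)                                ≡⟨ *-assoc (b (suc n)) 2 t ⟨
    b (suc n) * 2 * t                                  ≡⟨ cong (_* t) (*-comm (b (suc n)) 2) ⟩
    2 * b (suc n) * t                                  ≤⟨ *-monoˡ-≤ t (b-step n) ⟩
    (13 * a n + b n) * t                               ≡⟨ expand (a n) (b n) t ⟩
    13 * (a n * t) + b n * t                           ≤⟨ +-mono-≤ (*-monoʳ-≤ 13 a-bound) b-bound ⟩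
    13 * (a 0 * P n + b 0 * Q n) + (b 0 * P n + 13 * a 0 * Q n) ≡⟨ regroup (a 0) (b 0) (P n) (Q n) ⟩
    b 0 * (P n + 13 * Q n) + 13 * a 0 * (P n + Q n)    ∎
    where
    expand : ∀ x y t → (13 * x + y) * t ≡ 13 * (x * t) + y * t
    expand = solve-∀
    regroup : ∀ x y p q → 13 * (x * p + y * q) + (y * p + 13 * x * q) ≡ y * (p + 13 * q) + 13 * x * (p + q)
    regroup = solve-∀

-- The constants close the induction: c + d + (2c + d) ≤ 3c + 2d and 13c + d + (3c + 2d) ≤ 13(2c + d).
cumulative-growth : ∀ (g k : ℕ → ℕ) c d → (∀ n → g n * 2 ^ n ≤ c * P n + d * Q n) →
  k 0 ≡ g 0 → (∀ n → k (suc n) ≡ g (suc n) + k n) →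
  ∀ n → k n * 2 ^ n ≤ (2 * c + d) * P n + (3 * c + 2 * d) * Q n
cumulative-growth g k c d g-bound k₀ k-step zero = begin
  k 0 * 1                                   ≡⟨ cong (_* 1) k₀ ⟩
  g 0 * 1                                   ≤⟨ g-bound 0 ⟩
  c * 1 + d * 0                             ≤⟨ m≤m+n (c * 1 + d * 0) (c + d) ⟩
  c * 1 + d * 0 + (c + d)                   ≡⟨ regroup c d ⟩
  (2 * c + d) * 1 + (3 * c + 2 * d) * 0     ∎
  where
  open ≤-Reasoning
  regroup : ∀ c d → c * 1 + d * 0 + (c + d) ≡ (2 * c + d) * 1 + (3 * c + 2 * d) * 0
  regroup = solve-∀
cumulative-growth g k c d g-bound k₀ k-step (suc n) = begin
  k (suc n) * (2 * t)                                     ≡⟨ cong (_* (2 * t)) (k-step n) ⟩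
  (g (suc n) + k n) * (2 * t)                             ≡⟨ expand (g (suc n)) (k n) t ⟩
  g (suc n) * (2 * t) + 2 * (k n * t)
    ≤⟨ +-mono-≤ (g-bound (suc n)) (*-monoʳ-≤ 2 (cumulative-growth g k c d g-bound k₀ k-step n)) ⟩
  c * P (suc n) + d * Q (suc n) + 2 * ((2 * c + d) * P n + (3 * c + 2 * d) * Q n)
    ≤⟨ m≤m+n _ (10 * (c + d) * Q n) ⟩
  c * P (suc n) + d * Q (suc n) + 2 * ((2 * c + d) * P n + (3 * c + 2 * d) * Q n) + 10 * (c + d) * Q n
    ≡⟨ regroup c d (P n) (Q n) ⟩
  (2 * c + d) * P (suc n) + (3 * c + 2 * d) * Q (suc n)   ∎
  where
  open ≤-Reasoning
  t = 2 ^ n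
  expand : ∀ x y t → (x + y) * (2 * t) ≡ x * (2 * t) + 2 * (y * t)
  expand = solve-∀
  regroup : ∀ c d p q →
    c * (p + 13 * q) + d * (p + q) + 2 * ((2 * c + d) * p + (3 * c + 2 * d) * q) + 10 * (c + d) * q
      ≡ (2 * c + d) * (p + 13 * q) + (3 * c + 2 * d) * (p + q)
  regroup = solve-∀

LeCλ^-intro : ∀ x C n → x * 2 ^ n ≤ C * P n + C * Q n → LeCλ^ x C n
LeCλ^-intro x C n x2ⁿ≤ with sqPQ n
... | p , q = inj₂ (≤-trans (*-mono-≤ excess≤ excess≤) (m≤n*m (C * q * (C * q)) 13))
  where
  excess≤ : x * 2 ^ n ∸ C * p ≤ C * q
  excess≤ = m≤n+o⇒m∸n≤o (x * 2 ^ n) (C * p) x2ⁿ≤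

-- Rewriting words in the generators

Word : Set
Word = List (Fin 4)

s₁ s₂ s₃ s₄ : Fin 4
s₁ = # 0
s₂ = # 1
s₃ = # 2
s₄ = # 3

evalWord-++ : ∀ u v → evalWord (u ++ v) ≡ evalWord u ⊗ evalWord v
evalWord-++ []      v = sym (⊗-identityˡ (evalWord v))
evalWord-++ (a ∷ u) v = trans (cong (S a ⊗_) (evalWord-++ u v)) (sym (⊗-assoc (S a) (evalWord u) (evalWord v)))

-- The bijective base-4 numeral with digits 1 … 4: comparing ranks is comparing words in shortlex order.
rank : Word → ℕ
rank []      = 0
rank (a ∷ w) = suc (toℕ a) * 4 ^ length w + rank w

rank-++ : ∀ u v → rank (u ++ v) ≡ rank u * 4 ^ length v + rank v
rank-++ []      v = refl
rank-++ (a ∷ u) v = begin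
  d * 4 ^ length (u ++ v) + rank (u ++ v)
    ≡⟨ cong₂ (λ m r → d * 4 ^ m + r) (length-++ u) (rank-++ u v) ⟩
  d * 4 ^ (length u + length v) + (rank u * 4 ^ length v + rank v)
    ≡⟨ cong (λ p → d * p + (rank u * 4 ^ length v + rank v)) (^-distribˡ-+-* 4 (length u) (length v)) ⟩
  d * (4 ^ length u * 4 ^ length v) + (rank u * 4 ^ length v + rank v)
    ≡⟨ regroup d (4 ^ length u) (4 ^ length v) (rank u) (rank v) ⟩
  (d * 4 ^ length u + rank u) * 4 ^ length v + rank v ∎
  where
  open ≡-Reasoning
  d = suc (toℕ a)
  regroup : ∀ d p q r s → d * (p * q) + (r * q + s) ≡ (d * p + r) * q + s
  regroup = solve-∀

record _↝_ (w v : Word) : Set where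
  field
    value-≡  : evalWord w ≡ evalWord v
    length-≤ : length v ≤ length w
    rank-<   : rank v < rank w
open _↝_

_↝?_ : ∀ w v → Dec (w ↝ v)
w ↝? v = map′ (λ (e , l , r) → record { value-≡ = e ; length-≤ = l ; rank-< = r })
              (λ w↝v → value-≡ w↝v , length-≤ w↝v , rank-< w↝v)
              (≡-dec (≡-dec ℤ._≟_) (evalWord w) (evalWord v) ×-dec (length v ≤? length w) ×-dec (rank v <? rank w))

↝-∷ : ∀ {w v} a → w ↝ v → (a ∷ w) ↝ (a ∷ v)
↝-∷ a w↝v = record
  { value-≡  = cong (S a ⊗_) (value-≡ w↝v)
  ; length-≤ = s≤s (length-≤ w↝v)
  ; rank-<   = +-mono-≤-< (*-monoʳ-≤ (suc (toℕ a)) (^-monoʳ-≤ 4 (length-≤ w↝v))) (rank-< w↝v)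
  }

↝-++ʳ : ∀ {w v} s → w ↝ v → (w ++ s) ↝ (v ++ s)
↝-++ʳ {w} {v} s w↝v = record
  { value-≡  = begin
      evalWord (w ++ s)         ≡⟨ evalWord-++ w s ⟩
      evalWord w ⊗ evalWord s   ≡⟨ cong (_⊗ evalWord s) (value-≡ w↝v) ⟩
      evalWord v ⊗ evalWord s   ≡⟨ evalWord-++ v s ⟨
      evalWord (v ++ s)         ∎
  ; length-≤ = subst₂ _≤_ (sym (length-++ v)) (sym (length-++ w)) (+-monoˡ-≤ (length s) (length-≤ w↝v))
  ; rank-<   = subst₂ _<_ (sym (rank-++ v s)) (sym (rank-++ w s))
                 (+-monoˡ-< (rank s) (*-monoˡ-< (4 ^ length s) {{m^n≢0 4 (length s)}} (rank-< w↝v)))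
  }
  where open ≡-Reasoning

relations : List (Word × Word)
relations =
  (s₁ ∷ s₁ ∷ [] , [])
  ∷ (s₂ ∷ s₂ ∷ [] , [])
  ∷ (s₃ ∷ s₃ ∷ [] , [])
  ∷ (s₄ ∷ s₄ ∷ [] , [])
  ∷ (s₂ ∷ s₁ ∷ s₂ ∷ [] , s₁ ∷ s₂ ∷ s₁ ∷ [])
  ∷ (s₃ ∷ s₁ ∷ s₃ ∷ [] , s₁ ∷ s₃ ∷ s₁ ∷ [])
  ∷ (s₃ ∷ s₂ ∷ s₃ ∷ [] , s₂ ∷ s₃ ∷ s₂ ∷ [])
  ∷ (s₄ ∷ s₁ ∷ s₄ ∷ [] , s₁ ∷ s₄ ∷ s₁ ∷ [])
  ∷ (s₄ ∷ s₂ ∷ s₄ ∷ [] , s₂ ∷ s₄ ∷ s₂ ∷ [])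
  ∷ (s₄ ∷ s₃ ∷ s₄ ∷ [] , s₃ ∷ s₄ ∷ s₃ ∷ [])
  ∷ (s₃ ∷ s₁ ∷ s₂ ∷ s₃ ∷ s₂ ∷ [] , s₁ ∷ s₃ ∷ s₁ ∷ s₂ ∷ s₃ ∷ [])
  ∷ (s₃ ∷ s₂ ∷ s₁ ∷ s₃ ∷ s₁ ∷ [] , s₂ ∷ s₃ ∷ s₂ ∷ s₁ ∷ s₃ ∷ [])
  ∷ (s₄ ∷ s₁ ∷ s₂ ∷ s₄ ∷ s₂ ∷ [] , s₁ ∷ s₄ ∷ s₁ ∷ s₂ ∷ s₄ ∷ [])
  ∷ (s₄ ∷ s₁ ∷ s₃ ∷ s₄ ∷ s₃ ∷ [] , s₁ ∷ s₄ ∷ s₁ ∷ s₃ ∷ s₄ ∷ [])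
  ∷ (s₄ ∷ s₂ ∷ s₁ ∷ s₄ ∷ s₁ ∷ [] , s₂ ∷ s₄ ∷ s₂ ∷ s₁ ∷ s₄ ∷ [])
  ∷ (s₄ ∷ s₂ ∷ s₃ ∷ s₄ ∷ s₃ ∷ [] , s₂ ∷ s₄ ∷ s₂ ∷ s₃ ∷ s₄ ∷ [])
  ∷ (s₄ ∷ s₃ ∷ s₁ ∷ s₄ ∷ s₁ ∷ [] , s₃ ∷ s₄ ∷ s₃ ∷ s₁ ∷ s₄ ∷ [])
  ∷ (s₄ ∷ s₃ ∷ s₂ ∷ s₄ ∷ s₂ ∷ [] , s₃ ∷ s₄ ∷ s₃ ∷ s₂ ∷ s₄ ∷ [])
  ∷ (s₃ ∷ s₁ ∷ s₂ ∷ s₃ ∷ s₁ ∷ s₂ ∷ s₁ ∷ [] , s₁ ∷ s₃ ∷ s₁ ∷ s₂ ∷ s₃ ∷ s₁ ∷ s₂ ∷ [])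
  ∷ (s₄ ∷ s₁ ∷ s₂ ∷ s₄ ∷ s₁ ∷ s₂ ∷ s₁ ∷ [] , s₁ ∷ s₄ ∷ s₁ ∷ s₂ ∷ s₄ ∷ s₁ ∷ s₂ ∷ [])
  ∷ (s₄ ∷ s₁ ∷ s₃ ∷ s₄ ∷ s₁ ∷ s₃ ∷ s₁ ∷ [] , s₁ ∷ s₄ ∷ s₁ ∷ s₃ ∷ s₄ ∷ s₁ ∷ s₃ ∷ [])
  ∷ (s₄ ∷ s₁ ∷ s₃ ∷ s₄ ∷ s₂ ∷ s₃ ∷ s₂ ∷ [] , s₁ ∷ s₄ ∷ s₁ ∷ s₃ ∷ s₄ ∷ s₂ ∷ s₃ ∷ [])
  ∷ (s₄ ∷ s₂ ∷ s₃ ∷ s₄ ∷ s₁ ∷ s₃ ∷ s₁ ∷ [] , s₂ ∷ s₄ ∷ s₂ ∷ s₃ ∷ s₄ ∷ s₁ ∷ s₃ ∷ [])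
  ∷ (s₄ ∷ s₂ ∷ s₃ ∷ s₄ ∷ s₂ ∷ s₃ ∷ s₂ ∷ [] , s₂ ∷ s₄ ∷ s₂ ∷ s₃ ∷ s₄ ∷ s₂ ∷ s₃ ∷ [])
  ∷ (s₄ ∷ s₃ ∷ s₂ ∷ s₄ ∷ s₁ ∷ s₂ ∷ s₁ ∷ [] , s₃ ∷ s₄ ∷ s₃ ∷ s₂ ∷ s₄ ∷ s₁ ∷ s₂ ∷ [])
  ∷ (s₄ ∷ s₁ ∷ s₃ ∷ s₄ ∷ s₂ ∷ s₃ ∷ s₁ ∷ s₂ ∷ s₁ ∷ [] , s₁ ∷ s₄ ∷ s₁ ∷ s₃ ∷ s₄ ∷ s₂ ∷ s₃ ∷ s₁ ∷ s₂ ∷ [])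
  ∷ (s₄ ∷ s₂ ∷ s₃ ∷ s₄ ∷ s₂ ∷ s₃ ∷ s₁ ∷ s₂ ∷ s₁ ∷ [] , s₂ ∷ s₄ ∷ s₂ ∷ s₃ ∷ s₄ ∷ s₂ ∷ s₃ ∷ s₁ ∷ s₂ ∷ [])
  ∷ []

relations-sound : All (uncurry _↝_) relations
relations-sound = from-yes (All.all? (uncurry _↝?_) relations)

HeadRedex : Word → Set
HeadRedex w = Any (λ (l , _) → Prefix _≡_ l w) relations

headRedex? : ∀ w → Dec (HeadRedex w)
headRedex? w = any? (λ (l , _) → prefix? _≟ᶠ_ l w) relations

headRedex-↝ : ∀ {w} → HeadRedex w → Σ Word (w ↝_)
headRedex-↝ {w} = All.lookupWith rewrite-prefix relations-sound
  where
  rewrite-prefix : ∀ {(l , r) : Word × Word} → l ↝ r → Prefix _≡_ l w → Σ Word (w ↝_)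
  rewrite-prefix {l , r} l↝r l≼w with Prefix-as-∣ˡ l≼w
  ... | record { quotient = s ; equality = refl } = r ++ s , ↝-++ʳ s l↝r

HeadRedex-prefix : ∀ {y w} → Prefix _≡_ y w → HeadRedex y → HeadRedex w
HeadRedex-prefix y≼w = Any.map (λ l≼y → Prefix.trans trans l≼y y≼w)

data Irreducible : Word → Set where
  []  : Irreducible []
  _∷_ : ∀ {a w} → ¬ HeadRedex (a ∷ w) → Irreducible w → Irreducible (a ∷ w)

irreducible-or-↝ : ∀ w → Irreducible w ⊎ Σ Word (w ↝_)
irreducible-or-↝ []      = inj₁ []
irreducible-or-↝ (a ∷ w) with headRedex? (a ∷ w) | irreducible-or-↝ w
... | yes redex | _              = inj₂ (headRedex-↝ redex)
... | no ¬redex | inj₁ irr       = inj₁ (¬redex ∷ irr)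
... | no _      | inj₂ (v , w↝v) = inj₂ (a ∷ v , ↝-∷ a w↝v)

InW-irreducible : ∀ {n M} → InW n M → Σ Word λ v → Irreducible v × length v ≤ n × evalWord v ≡ M
InW-irreducible (w , |w|≤n , w≡M) = go w (<-wellFounded (rank w)) |w|≤n w≡M
  where
  go : ∀ {n M} w → Acc _<_ (rank w) → length w ≤ n → evalWord w ≡ M →
       Σ Word λ v → Irreducible v × length v ≤ n × evalWord v ≡ M
  go w (acc smaller) |w|≤n w≡M with irreducible-or-↝ w
  ... | inj₁ irr       = w , irr , |w|≤n , w≡M
  ... | inj₂ (v , w↝v) =
    go v (smaller (rank-< w↝v)) (≤-trans (length-≤ w↝v) |w|≤n) (trans (sym (value-≡ w↝v)) w≡M)

-- An automaton accepting all irreducible words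

State : Set
State = Fin 50

-- Words are read from the right; after reading w the automaton remembers only the prefix
-- stateWord (state w) of w, which is why it may accept more than the irreducible words.
stateWords : Vec Word 50
stateWords =
  []
  ∷ (s₁ ∷ [])
  ∷ (s₂ ∷ [])
  ∷ (s₃ ∷ [])
  ∷ (s₄ ∷ [])
  ∷ (s₁ ∷ s₂ ∷ [])
  ∷ (s₁ ∷ s₃ ∷ [])
  ∷ (s₁ ∷ s₄ ∷ [])
  ∷ (s₂ ∷ s₁ ∷ [])
  ∷ (s₂ ∷ s₃ ∷ [])
  ∷ (s₂ ∷ s₄ ∷ [])
  ∷ (s₃ ∷ s₁ ∷ [])
  ∷ (s₃ ∷ s₂ ∷ [])
  ∷ (s₃ ∷ s₄ ∷ [])
  ∷ (s₄ ∷ s₁ ∷ [])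
  ∷ (s₄ ∷ s₂ ∷ [])
  ∷ (s₄ ∷ s₃ ∷ [])
  ∷ (s₁ ∷ s₂ ∷ s₁ ∷ [])
  ∷ (s₁ ∷ s₃ ∷ s₁ ∷ [])
  ∷ (s₁ ∷ s₄ ∷ s₁ ∷ [])
  ∷ (s₂ ∷ s₃ ∷ s₂ ∷ [])
  ∷ (s₂ ∷ s₄ ∷ s₂ ∷ [])
  ∷ (s₃ ∷ s₄ ∷ s₃ ∷ [])
  ∷ (s₁ ∷ s₂ ∷ s₃ ∷ s₂ ∷ [])
  ∷ (s₁ ∷ s₂ ∷ s₄ ∷ s₂ ∷ [])
  ∷ (s₁ ∷ s₃ ∷ s₄ ∷ s₃ ∷ [])
  ∷ (s₂ ∷ s₁ ∷ s₃ ∷ s₁ ∷ [])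
  ∷ (s₂ ∷ s₁ ∷ s₄ ∷ s₁ ∷ [])
  ∷ (s₂ ∷ s₃ ∷ s₄ ∷ s₃ ∷ [])
  ∷ (s₃ ∷ s₁ ∷ s₂ ∷ s₁ ∷ [])
  ∷ (s₃ ∷ s₁ ∷ s₄ ∷ s₁ ∷ [])
  ∷ (s₃ ∷ s₂ ∷ s₄ ∷ s₂ ∷ [])
  ∷ (s₄ ∷ s₁ ∷ s₂ ∷ s₁ ∷ [])
  ∷ (s₄ ∷ s₁ ∷ s₃ ∷ s₁ ∷ [])
  ∷ (s₄ ∷ s₂ ∷ s₃ ∷ s₂ ∷ [])
  ∷ (s₂ ∷ s₃ ∷ s₁ ∷ s₂ ∷ s₁ ∷ [])
  ∷ (s₂ ∷ s₄ ∷ s₁ ∷ s₂ ∷ s₁ ∷ [])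
  ∷ (s₃ ∷ s₄ ∷ s₁ ∷ s₃ ∷ s₁ ∷ [])
  ∷ (s₃ ∷ s₄ ∷ s₂ ∷ s₃ ∷ s₂ ∷ [])
  ∷ (s₁ ∷ s₂ ∷ s₃ ∷ s₁ ∷ s₂ ∷ s₁ ∷ [])
  ∷ (s₁ ∷ s₂ ∷ s₄ ∷ s₁ ∷ s₂ ∷ s₁ ∷ [])
  ∷ (s₁ ∷ s₃ ∷ s₄ ∷ s₁ ∷ s₃ ∷ s₁ ∷ [])
  ∷ (s₁ ∷ s₃ ∷ s₄ ∷ s₂ ∷ s₃ ∷ s₂ ∷ [])
  ∷ (s₂ ∷ s₃ ∷ s₄ ∷ s₁ ∷ s₃ ∷ s₁ ∷ [])
  ∷ (s₂ ∷ s₃ ∷ s₄ ∷ s₂ ∷ s₃ ∷ s₂ ∷ [])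
  ∷ (s₃ ∷ s₂ ∷ s₄ ∷ s₁ ∷ s₂ ∷ s₁ ∷ [])
  ∷ (s₄ ∷ s₂ ∷ s₃ ∷ s₁ ∷ s₂ ∷ s₁ ∷ [])
  ∷ (s₃ ∷ s₄ ∷ s₂ ∷ s₃ ∷ s₁ ∷ s₂ ∷ s₁ ∷ [])
  ∷ (s₁ ∷ s₃ ∷ s₄ ∷ s₂ ∷ s₃ ∷ s₁ ∷ s₂ ∷ s₁ ∷ [])
  ∷ (s₂ ∷ s₃ ∷ s₄ ∷ s₂ ∷ s₃ ∷ s₁ ∷ s₂ ∷ s₁ ∷ [])
  ∷ []

transitions : Vec (Vec (Fin 50) 4) 50
transitions =
  (# 1 ∷ # 2 ∷ # 3 ∷ # 4 ∷ [])
  ∷ (# 1 ∷ # 8 ∷ # 11 ∷ # 14 ∷ [])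
  ∷ (# 5 ∷ # 2 ∷ # 12 ∷ # 15 ∷ [])
  ∷ (# 6 ∷ # 9 ∷ # 3 ∷ # 16 ∷ [])
  ∷ (# 7 ∷ # 10 ∷ # 13 ∷ # 4 ∷ [])
  ∷ (# 1 ∷ # 8 ∷ # 11 ∷ # 14 ∷ [])
  ∷ (# 1 ∷ # 8 ∷ # 11 ∷ # 14 ∷ [])
  ∷ (# 1 ∷ # 8 ∷ # 11 ∷ # 14 ∷ [])
  ∷ (# 17 ∷ # 2 ∷ # 12 ∷ # 15 ∷ [])
  ∷ (# 5 ∷ # 2 ∷ # 12 ∷ # 15 ∷ [])
  ∷ (# 5 ∷ # 2 ∷ # 12 ∷ # 15 ∷ [])
  ∷ (# 18 ∷ # 9 ∷ # 3 ∷ # 16 ∷ [])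
  ∷ (# 6 ∷ # 20 ∷ # 3 ∷ # 16 ∷ [])
  ∷ (# 6 ∷ # 9 ∷ # 3 ∷ # 16 ∷ [])
  ∷ (# 19 ∷ # 10 ∷ # 13 ∷ # 4 ∷ [])
  ∷ (# 7 ∷ # 21 ∷ # 13 ∷ # 4 ∷ [])
  ∷ (# 7 ∷ # 10 ∷ # 22 ∷ # 4 ∷ [])
  ∷ (# 1 ∷ # 8 ∷ # 29 ∷ # 32 ∷ [])
  ∷ (# 1 ∷ # 26 ∷ # 11 ∷ # 33 ∷ [])
  ∷ (# 1 ∷ # 27 ∷ # 30 ∷ # 14 ∷ [])
  ∷ (# 23 ∷ # 2 ∷ # 12 ∷ # 34 ∷ [])
  ∷ (# 24 ∷ # 2 ∷ # 31 ∷ # 15 ∷ [])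
  ∷ (# 25 ∷ # 28 ∷ # 3 ∷ # 16 ∷ [])
  ∷ (# 1 ∷ # 8 ∷ # 11 ∷ # 14 ∷ [])
  ∷ (# 1 ∷ # 8 ∷ # 11 ∷ # 14 ∷ [])
  ∷ (# 1 ∷ # 8 ∷ # 11 ∷ # 14 ∷ [])
  ∷ (# 17 ∷ # 2 ∷ # 12 ∷ # 15 ∷ [])
  ∷ (# 17 ∷ # 2 ∷ # 12 ∷ # 15 ∷ [])
  ∷ (# 5 ∷ # 2 ∷ # 12 ∷ # 15 ∷ [])
  ∷ (# 18 ∷ # 35 ∷ # 3 ∷ # 16 ∷ [])
  ∷ (# 18 ∷ # 9 ∷ # 3 ∷ # 16 ∷ [])
  ∷ (# 6 ∷ # 20 ∷ # 3 ∷ # 16 ∷ [])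
  ∷ (# 19 ∷ # 36 ∷ # 13 ∷ # 4 ∷ [])
  ∷ (# 19 ∷ # 10 ∷ # 37 ∷ # 4 ∷ [])
  ∷ (# 7 ∷ # 21 ∷ # 38 ∷ # 4 ∷ [])
  ∷ (# 39 ∷ # 2 ∷ # 12 ∷ # 46 ∷ [])
  ∷ (# 40 ∷ # 2 ∷ # 45 ∷ # 15 ∷ [])
  ∷ (# 41 ∷ # 43 ∷ # 3 ∷ # 16 ∷ [])
  ∷ (# 42 ∷ # 44 ∷ # 3 ∷ # 16 ∷ [])
  ∷ (# 1 ∷ # 8 ∷ # 11 ∷ # 14 ∷ [])
  ∷ (# 1 ∷ # 8 ∷ # 11 ∷ # 14 ∷ [])
  ∷ (# 1 ∷ # 8 ∷ # 11 ∷ # 14 ∷ [])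
  ∷ (# 1 ∷ # 8 ∷ # 11 ∷ # 14 ∷ [])
  ∷ (# 5 ∷ # 2 ∷ # 12 ∷ # 15 ∷ [])
  ∷ (# 5 ∷ # 2 ∷ # 12 ∷ # 15 ∷ [])
  ∷ (# 6 ∷ # 20 ∷ # 3 ∷ # 16 ∷ [])
  ∷ (# 7 ∷ # 21 ∷ # 47 ∷ # 4 ∷ [])
  ∷ (# 48 ∷ # 49 ∷ # 3 ∷ # 16 ∷ [])
  ∷ (# 1 ∷ # 8 ∷ # 11 ∷ # 14 ∷ [])
  ∷ (# 5 ∷ # 2 ∷ # 12 ∷ # 15 ∷ [])
  ∷ []

stateWord : State → Word
stateWord = lookup stateWords

δ : Fin 4 → State → State
δ a q = lookup (lookup transitions q) a

initial : State
initial = zero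

state : Word → State
state []      = initial
state (a ∷ w) = δ a (state w)

δ-prefix : ∀ a q → Prefix _≡_ (stateWord (δ a q)) (a ∷ stateWord q)
δ-prefix = from-yes (all? λ a → all? λ q → prefix? _≟ᶠ_ (stateWord (δ a q)) (a ∷ stateWord q))

stateWord-prefix : ∀ w → Prefix _≡_ (stateWord (state w)) w
stateWord-prefix []      = []
stateWord-prefix (a ∷ w) = Prefix.trans trans (δ-prefix a (state w)) (refl ∷ stateWord-prefix w)

Allowed : Fin 4 → State → Set
Allowed a q = ¬ HeadRedex (a ∷ stateWord q)

allowed? : ∀ a q → Dec (Allowed a q)
allowed? a q = ¬? (headRedex? (a ∷ stateWord q))

data Accepted : Word → Set where
  []  : Accepted []
  _∷_ : ∀ {a w} → Allowed a (state w) → Accepted w → Accepted (a ∷ w)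

Irreducible⇒Accepted : ∀ {w} → Irreducible w → Accepted w
Irreducible⇒Accepted []                   = []
Irreducible⇒Accepted {_ ∷ w} (¬redex ∷ irr) =
  (¬redex ∘ HeadRedex-prefix (refl ∷ stateWord-prefix w)) ∷ Irreducible⇒Accepted irr

allowedLetters : State → List (Fin 4)
allowedLetters q = filter (λ a → allowed? a q) (allFin 4)

children : Word × State → List (Word × State)
children (w , q) = map (λ a → a ∷ w , δ a q) (allowedLetters q)

layer : ℕ → List (Word × State)
layer zero    = ([] , initial) ∷ []
layer (suc n) = concatMap children (layer n)

ball : ℕ → List (Word × State)
ball zero    = layer zero
ball (suc n) = layer (suc n) ++ ball n

Accepted⇒∈layer : ∀ {w} → Accepted w → (w , state w) ∈ layer (length w)
Accepted⇒∈layer []                   = here refl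
Accepted⇒∈layer {a ∷ w} (ok ∷ accepted) =
  ∈-concat⁺′ (∈-map⁺ (λ b → b ∷ w , δ b (state w)) (∈-filter⁺ (λ b → allowed? b (state w)) (∈-allFin a) ok))
             (∈-map⁺ children (Accepted⇒∈layer accepted))

layer⊆ball : ∀ {m n x} → m ≤ n → x ∈ layer m → x ∈ ball n
layer⊆ball {n = zero}  z≤n x∈layer = x∈layer
layer⊆ball {n = suc n} m≤1+n x∈layer with m≤n⇒m<n∨m≡n m≤1+n
... | inj₁ m<1+n = ∈-++⁺ʳ (layer (suc n)) (layer⊆ball (s≤s⁻¹ m<1+n) x∈layer)
... | inj₂ refl  = ∈-++⁺ˡ x∈layer

-- Counting accepted words

weight : (State → ℕ) → List (Word × State) → ℕ
weight f ps = sum (map (f ∘ proj₂) ps)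

weight-++ : ∀ f ps qs → weight f (ps ++ qs) ≡ weight f ps + weight f qs
weight-++ f ps qs = trans (cong sum (map-++ (f ∘ proj₂) ps qs)) (sum-++ (map (f ∘ proj₂) ps) (map (f ∘ proj₂) qs))

weight-+ : ∀ f g ps → weight (λ q → f q + g q) ps ≡ weight f ps + weight g ps
weight-+ f g []             = refl
weight-+ f g ((_ , q) ∷ ps) = trans (cong (λ x → f q + g q + x) (weight-+ f g ps)) (+-exchange (f q) (g q) _ _)
  where
  +-exchange : ∀ a b c d → (a + b) + (c + d) ≡ (a + c) + (b + d)
  +-exchange = solve-∀

weight-* : ∀ k f ps → weight (λ q → k * f q) ps ≡ k * weight f ps
weight-* k f []             = sym (*-zeroʳ k)
weight-* k f ((_ , q) ∷ ps) = trans (cong (λ x → k * f q + x) (weight-* k f ps)) (sym (*-distribˡ-+ k (f q) _))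

successorWeight : (State → ℕ) → State → ℕ
successorWeight f q = sum (map (λ a → f (δ a q)) (allowedLetters q))

weight-children : ∀ f w q → weight f (children (w , q)) ≡ successorWeight f q
weight-children f w q = cong sum (sym (map-∘ (allowedLetters q)))

length≤weight : ∀ {f} → (∀ q → 1 ≤ f q) → ∀ ps → length ps ≤ weight f ps
length≤weight f≥1 []             = z≤n
length≤weight f≥1 ((_ , q) ∷ ps) = +-mono-≤ (f≥1 q) (length≤weight f≥1 ps)

weight-concatMap-children : ∀ f g → (∀ q → 2 * successorWeight f q ≤ g q) →
                            ∀ ps → 2 * weight f (concatMap children ps) ≤ weight g ps
weight-concatMap-children f g local []             = z≤n
weight-concatMap-children f g local ((w , q) ∷ ps) = begin
  2 * weight f (children (w , q) ++ concatMap children ps)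
    ≡⟨ cong (2 *_) (weight-++ f (children (w , q)) (concatMap children ps)) ⟩
  2 * (weight f (children (w , q)) + weight f (concatMap children ps))
    ≡⟨ *-distribˡ-+ 2 (weight f (children (w , q))) _ ⟩
  2 * weight f (children (w , q)) + 2 * weight f (concatMap children ps)
    ≤⟨ +-mono-≤ (subst (λ x → 2 * x ≤ g q) (sym (weight-children f w q)) (local q))
                (weight-concatMap-children f g local ps) ⟩
  g q + weight g ps ∎
  where open ≤-Reasoning

αTable : Vec ℕ 50
αTable =
  6804 ∷ 6723 ∷ 4968 ∷ 4422 ∷ 4137 ∷ 4347 ∷ 4490 ∷ 4609 ∷ 3996 ∷ 2735 ∷
  2854 ∷ 3307 ∷ 3307 ∷ 2308 ∷ 2903 ∷ 2903 ∷ 2903 ∷ 4914 ∷ 4368 ∷ 4083 ∷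
  2613 ∷ 2328 ∷ 1782 ∷ 2114 ∷ 2233 ∷ 2376 ∷ 1763 ∷ 1882 ∷ 621 ∷ 2192 ∷
  1193 ∷ 1193 ∷ 1669 ∷ 1669 ∷ 1669 ∷ 2613 ∷ 2328 ∷ 1782 ∷ 1782 ∷ 2114 ∷
  2233 ∷ 2376 ∷ 2376 ∷ 621 ∷ 621 ∷ 1193 ∷ 1669 ∷ 1782 ∷ 2376 ∷ 621 ∷ []

βTable : Vec ℕ 50
βTable =
  33696 ∷ 13689 ∷ 16146 ∷ 15834 ∷ 15405 ∷ 8073 ∷ 9308 ∷ 9997 ∷ 18252 ∷ 11765 ∷
  12454 ∷ 16705 ∷ 16705 ∷ 12142 ∷ 15587 ∷ 15587 ∷ 15587 ∷ 2808 ∷ 2496 ∷ 2067 ∷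
  4953 ∷ 4524 ∷ 4212 ∷ 3692 ∷ 4381 ∷ 5616 ∷ 13871 ∷ 14560 ∷ 8073 ∷ 17576 ∷
  13013 ∷ 13013 ∷ 15769 ∷ 15769 ∷ 15769 ∷ 4953 ∷ 4524 ∷ 4212 ∷ 4212 ∷ 3692 ∷
  4381 ∷ 5616 ∷ 5616 ∷ 8073 ∷ 8073 ∷ 13013 ∷ 15769 ∷ 4212 ∷ 5616 ∷ 8073 ∷ []

α β : State → ℕ
α = lookup αTable
β = lookup βTable

α-positive : ∀ q → 1 ≤ α q
α-positive = from-yes (all? λ q → 1 ≤? α q)

α-children : ∀ q → 2 * successorWeight α q ≤ α q + β q
α-children = from-yes (all? λ q → 2 * successorWeight α q ≤? α q + β q)

β-children : ∀ q → 2 * successorWeight β q ≤ 13 * α q + β q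
β-children = from-yes (all? λ q → 2 * successorWeight β q ≤? 13 * α q + β q)

layer-α : ∀ n → 2 * weight α (layer (suc n)) ≤ weight α (layer n) + weight β (layer n)
layer-α n = subst (2 * weight α (layer (suc n)) ≤_) (weight-+ α β (layer n))
  (weight-concatMap-children α (λ q → α q + β q) α-children (layer n))

layer-β : ∀ n → 2 * weight β (layer (suc n)) ≤ 13 * weight α (layer n) + weight β (layer n)
layer-β n = subst (2 * weight β (layer (suc n)) ≤_)
  (trans (weight-+ (λ q → 13 * α q) β (layer n)) (cong (_+ weight β (layer n)) (weight-* 13 α (layer n))))
  (weight-concatMap-children β (λ q → 13 * α q + β q) β-children (layer n))

C : ℕ
C = 3 * α initial + 2 * β initial

ball-growth : ∀ n → length (ball n) * 2 ^ n ≤ C * P n + C * Q n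
ball-growth n = ≤-trans
  (cumulative-growth (length ∘ layer) (length ∘ ball) (α initial) (β initial) layer-bound refl
    (λ n → length-++ (layer (suc n))) n)
  (+-monoˡ-≤ (C * Q n) (*-monoˡ-≤ (P n) (from-yes (2 * α initial + β initial ≤? C))))
  where
  layer-bound : ∀ n → length (layer n) * 2 ^ n ≤ α initial * P n + β initial * Q n
  layer-bound n = ≤-trans (*-monoˡ-≤ (2 ^ n) (length≤weight α-positive (layer n)))
                          (proj₁ (λ-growth (weight α ∘ layer) (weight β ∘ layer) layer-α layer-β n))

InW⇒∈ball : ∀ {n M} → InW n M → M ∈ map (evalWord ∘ proj₁) (ball n)
InW⇒∈ball M∈Wₙ with InW-irreducible M∈Wₙ
... | v , irr , |v|≤n , refl =
  ∈-map⁺ (evalWord ∘ proj₁) (layer⊆ball |v|≤n (Accepted⇒∈layer (Irreducible⇒Accepted irr)))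

length≤ball : ∀ {n} L → Unique L → ((M : Mat) → (M ∈ L) ⇔ InW n M) → length L ≤ length (ball n)
length≤ball {n} L unique L⇔Wₙ = subst (length L ≤_) (length-map (evalWord ∘ proj₁) (ball n))
  (Unique-⊆⇒length≤ unique λ {M} M∈L → InW⇒∈ball (Equivalence.to (L⇔Wₙ M) M∈L))

theorem5 : Σ ℕ λ C → Σ ℕ λ N → (n : ℕ) → N ≤ n →
    (L : List Mat) → Unique L → ((M : Mat) → (M ∈ L) ⇔ InW n M) →
    LeCλ^ (length L) C n
theorem5 = C , 0 , λ n _ L unique L⇔Wₙ →
  LeCλ^-intro (length L) C n (≤-trans (*-monoˡ-≤ (2 ^ n) (length≤ball L unique L⇔Wₙ)) (ball-growth n))
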